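{- Let $\mathcal A$ be any one of the second-order cellular automata $\mathcal R_1,\mathcal R_2,\mathcal R_3,\mathcal R_3'$ defined in the context, with initial configuration $C_0$ having state $(1,0)$ at cell $(0,0)$ and $(0,0)$ elsewhere, and for every integer $n$ (including negative $n$, via the inverse map) let $R_1(n)$ be the number of cells with value $1$ in $C_n$. Then $R_1(-1)=0$, $R_1(0)=1$, and for all integers $k\ge 0$ and $0\le j<2^k$, $$R_1(2^k+j)=4R_1(j)+R_1(2^k-j-2).$$
   Context: Cells are indexed by $(i,j)\in\mathbb Z^2$. For a binary configuration $c$ put $\Sigma^\times c_{i,j}=c_{i-1,j-1}+c_{i-1,j+1}+c_{i+1,j-1}+c_{i+1,j+1}$ and $\Sigma^+ c_{i,j}=c_{i,j-1}+c_{i,j+1}+c_{i+1,j}+c_{i-1,j}$. Two-state rules $c\mapsto f[c]$: $\mathcal C_1$: $c_{i,j}\mapsto \Sigma^\times c_{i,j}\bmod 2$; $\mathcal C_2$: $c_{i,j}\mapsto \Sigma^+ c_{i,j}\bmod 2$; $\mathcal C_3$: $c_{i,j}\mapsto 1$ if $\Sigma^+c_{i,j}=1$, else $0$; $\mathcal C_3'$: $c_{i,j}\mapsto 1$ if $\Sigma^+c_{i,j}=1$ and $\Sigma^\times c_{i,j}=0$, else $0$. The derived second-order automaton has at each cell a pair of bits $(c,c')$ and global map $F:(c,c')\mapsto (f[c]+c'\bmod 2,\ c)$ (applied simultaneously to all cells, $f[c]$ computed from the first components of the neighbours); it is invertible with inverse $(c,c')\mapsto (c',\ f[c']+c\bmod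 2)$. $C_n=F^n(C_0)$ for all $n\in\mathbb Z$. The value of a cell with state $(c,c')$ is $c+2c'$. -}

module Defs where

open import Data.Bool using (Bool; true; false; _xor_; _∧_; if_then_else_)
open import Data.Nat using (ℕ; zero; suc; _+_)
open import Data.Integer as ℤ using (ℤ; +_; -[1+_])
open import Data.Product using (_×_; _,_; proj₁; proj₂; Σ; ∃)
open import Data.List using (List; length)
open import Data.List.Membership.Propositional using (_∈_)
open import Data.List.Relation.Unary.Unique.Propositional using (Unique)
open import Function.Bundles using (_⇔_)
open import Relation.Binary.PropositionalEquality using (_≡_)

data Rule : Set where
  C1 C2 C3 C3' : Rule

Cell : Set
Cell = ℤ × ℤ

Config₁ : Set
Config₁ = ℤ → ℤ → Bool

Config₂ : Set
Config₂ = ℤ → ℤ → Bool × Bool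

b2n : Bool → ℕ
b2n false = 0
b2n true  = 1

sumX : Config₁ → ℤ → ℤ → ℕ
sumX c i j = b2n (c (i ℤ.- ℤ.1ℤ) (j ℤ.- ℤ.1ℤ)) + b2n (c (i ℤ.- ℤ.1ℤ) (j ℤ.+ ℤ.1ℤ))
           + b2n (c (i ℤ.+ ℤ.1ℤ) (j ℤ.- ℤ.1ℤ)) + b2n (c (i ℤ.+ ℤ.1ℤ) (j ℤ.+ ℤ.1ℤ))

sumP : Config₁ → ℤ → ℤ → ℕ
sumP c i j = b2n (c i (j ℤ.- ℤ.1ℤ)) + b2n (c i (j ℤ.+ ℤ.1ℤ))
           + b2n (c (i ℤ.+ ℤ.1ℤ) j) + b2n (c (i ℤ.- ℤ.1ℤ) j)

parity : ℕ → Bool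
parity zero = false
parity (suc n) = Data.Bool.not (parity n)
  where import Data.Bool

isOne : ℕ → Bool
isOne 1 = true
isOne _ = false

isZero : ℕ → Bool
isZero 0 = true
isZero _ = false

rule : Rule → Config₁ → Config₁
rule C1  c i j = parity (sumX c i j)
rule C2  c i j = parity (sumP c i j)
rule C3  c i j = isOne (sumP c i j)
rule C3' c i j = isOne (sumP c i j) ∧ isZero (sumX c i j)

first second : Config₂ → Config₁
first  C i j = proj₁ (C i j)
second C i j = proj₂ (C i j)

step : Rule → Config₂ → Config₂
step r C i j = (rule r (first C) i j xor second C i j , first C i j)

-- inverse : (c , c') ↦ (c' , f[c'] + c mod 2)
unstep : Rule → Config₂ → Config₂
unstep r C i j = (second C i j , rule r (second C) i j xor first C i j)

iter : (Config₂ → Config₂) → ℕ → Config₂ → Config₂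
iter g zero    C = C
iter g (suc n) C = g (iter g n C)

C₀ : Config₂
C₀ (+ 0) (+ 0) = (true , false)
C₀ _     _     = (false , false)

Cn : Rule → ℤ → Config₂
Cn r (+ n)     = iter (step r) n C₀
Cn r -[1+ n ]  = iter (unstep r) (suc n) C₀

value : Bool × Bool → ℕ
value (c , c') = b2n c + 2 Data.Nat.* b2n c'
  where import Data.Nat

NumValueOne : Config₂ → ℕ → Set
NumValueOne C m = Σ (List Cell) λ L →
  Unique L × (∀ i j → ((i , j) ∈ L) ⇔ (value (C i j) ≡ 1)) × length L ≡ m

module Submission where

-- Write Cₙ = (uₙ₊₁, uₙ).  For a rule following the XOR-linear rule L (plus for C2,
-- cross for C1) the uₙ form the orbit u₀ = 0, u₁ = seed, uₙ₊₂ = L uₙ₊₁ ⊕ uₙ, and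
-- running the automaton backwards gives C₋ₙ₋₁ = (uₙ, uₙ₊₁).  A checkerboard
-- colouring shows that uₙ lives on one colour alternating with n, so consecutive
-- uₙ are disjoint and a cell has value 1 iff it is live in uₙ₊₁; hence
-- R₁(n) = T(n + 1) with T(n) the number of live cells of uₙ.
-- Over 𝔽₂ the Frobenius identity plus ∘ plus = plus₂ makes the plus orbit
-- self-similar: u₂ₘ₊₁ is the dilation of uₘ₊₁ ⊕ uₘ, and u₂ₘ₊₂ is plus applied to
-- the dilation of uₘ₊₁.  This gives T(2m + 1) = T(m + 1) + T(m), T(2m) = 4 T(m),
-- and also that no cell ever has exactly three live plus-neighbours, so C3 and C3′
-- follow the plus orbit as well.  C1 is C2 on the lattice rotated by 45°, so it
-- has the same counts.  Finally T(2a + t) = 4 T(a) + T(t) whenever a + t = 2ᵏ, by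
-- induction on k, which is the recurrence with a = j + 1.

open import Defs
open import Data.Nat as ℕ using (ℕ; zero; suc; _^_; _<_; _*_)
open import Data.Integer as ℤ using (ℤ; +_; -[1+_]; _-_; _+_; 1ℤ; ∣_∣)
open import Data.Product using (Σ; _×_; _,_; proj₁; proj₂; uncurry)
import Data.Sum
open import Data.Sum using (_⊎_; inj₁; inj₂; [_,_]′)
open import Data.Bool as B using (Bool; true; false; _xor_; _∧_; not)
open import Data.Bool.Properties using (not-involutive; not-¬; ¬-not; ∧-conicalˡ; ∧-conicalʳ; xor-identityʳ; ∧-identityʳ)
import Data.Nat.Properties as ℕP
open import Data.Nat.Induction using (<-rec)
import Data.Integer.Properties as ℤP
open import Data.Integer.Tactic.RingSolver using (solve-∀)
import Data.Nat.Tactic.RingSolver as ℕS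
open import Relation.Nullary using (does; ¬_; yes; no)
open import Data.Empty using (⊥-elim)
open import Relation.Binary.PropositionalEquality
open import Data.List using (List; []; _∷_; _++_; map; length)
open import Data.List.Properties using (length-++; length-map)
open import Data.List.Membership.Propositional using (_∈_)
open import Data.List.Membership.Propositional.Properties using (∈-map⁺; ∈-map⁻; ∈-++⁺ˡ; ∈-++⁺ʳ; ∈-++⁻)
open import Data.List.Membership.Propositional.Properties.WithK using (unique∧set⇒bag)
open import Data.List.Relation.Unary.Any using (here; there)
open import Data.List.Relation.Unary.Unique.Propositional using (Unique)
import Data.List.Relation.Unary.Unique.Propositional.Properties as Unique
open import Data.List.Relation.Unary.AllPairs using ([]; _∷_)
import Data.List.Relation.Unary.All as All
open import Data.List.Relation.Binary.BagAndSetEquality using (∼bag⇒↭)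
open import Data.List.Relation.Binary.Permutation.Propositional.Properties using (↭-length)
open import Function.Bundles using (_⇔_; mk⇔; Equivalence)
open import Function.Definitions using (Injective)
import Function.Properties.Equivalence as ⇔

-- Boolean identities are checked by evaluating truth tables: a function of
-- n Boolean arguments is compared with another one on all 2ⁿ inputs.
BoolFn : ℕ → Set
BoolFn zero    = Bool
BoolFn (suc n) = Bool → BoolFn n

Pointwise : ∀ n → BoolFn n → BoolFn n → Set
Pointwise zero    f g = f ≡ g
Pointwise (suc n) f g = ∀ b → Pointwise n (f b) (g b)

sameTable : ∀ n → BoolFn n → BoolFn n → Bool
sameTable zero    f g = does (f B.≟ g)
sameTable (suc n) f g = sameTable n (f true) (g true) ∧ sameTable n (f false) (g false)

truthTable : ∀ n f g → sameTable n f g ≡ true → Pointwise n f g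
truthTable zero    true  true  _ = refl
truthTable zero    false false _ = refl
truthTable (suc n) f g same true  = truthTable n _ _ (∧-conicalˡ _ _ same)
truthTable (suc n) f g same false = truthTable n _ _ (∧-conicalʳ _ _ same)

true≢false : ¬ true ≡ false
true≢false ()

xor-true : ∀ {a b} → a xor b ≡ true → a ≡ true ⊎ b ≡ true
xor-true {true}  _ = inj₁ refl
xor-true {false} e = inj₂ e

xor4 : ∀ a b c d → a xor b xor c xor d ≡ true →
       a ≡ true ⊎ b ≡ true ⊎ c ≡ true ⊎ d ≡ true
xor4 true  b c d _ = inj₁ refl
xor4 false b c d e with xor-true {b} e
... | inj₁ b≡t = inj₂ (inj₁ b≡t)
... | inj₂ e′ with xor-true {c} e′
...   | inj₁ c≡t = inj₂ (inj₂ (inj₁ c≡t))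
...   | inj₂ d≡t = inj₂ (inj₂ (inj₂ d≡t))

flipped : ∀ {a b v} → a ≡ not b → a ≡ v → b ≡ not v
flipped {b = b} a≡¬b a≡v = trans (sym (not-involutive b)) (cong not (trans (sym a≡¬b) a≡v))

flipped-twice : ∀ {a b c} → a ≡ not b → b ≡ not c → a ≡ c
flipped-twice {c = c} a≡¬b b≡¬c = trans a≡¬b (trans (cong not b≡¬c) (not-involutive c))

inc dec dbl : ℤ → ℤ
inc x = x + 1ℤ
dec x = x - 1ℤ
dbl x = + 2 ℤ.* x

parityℤ : ℤ → Bool
parityℤ x = parity ∣ x ∣

parity-suc : ∀ n → parity (n ℕ.+ 1) ≡ not (parity n)
parity-suc zero    = refl
parity-suc (suc n) = cong not (parity-suc n)

parityℤ-inc : ∀ x → parityℤ (inc x) ≡ not (parityℤ x)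
parityℤ-inc (+ n)          = parity-suc n
parityℤ-inc -[1+ zero ]    = refl
parityℤ-inc -[1+ suc n ]   = sym (not-involutive _)

parityℤ-dec : ∀ x → parityℤ (dec x) ≡ not (parityℤ x)
parityℤ-dec (+ zero)    = refl
parityℤ-dec (+ suc n)   = sym (not-involutive _)
parityℤ-dec -[1+ n ]    = cong (λ m → parity (suc (suc m))) (ℕP.+-identityʳ n)

parity-double : ∀ n → parity (2 ℕ.* n) ≡ false
parity-double zero    = refl
parity-double (suc n) = trans (cong parity (ℕP.*-suc 2 n)) (trans (not-involutive _) (parity-double n))

parityℤ-dbl : ∀ x → parityℤ (dbl x) ≡ false
parityℤ-dbl (+ zero)   = refl
parityℤ-dbl (+ suc n)  = parity-double (suc n)
parityℤ-dbl -[1+ n ]   = trans (cong parityℤ (sym (ℤP.neg-distribʳ-* (+ 2) (+ suc n)))) (parity-double (suc n))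

parityℤ-odd : ∀ x → parityℤ (inc (dbl x)) ≡ true
parityℤ-odd x = trans (parityℤ-inc (dbl x)) (cong not (parityℤ-dbl x))

-- Ring identities moving ±1 across doubling; they are stated with inc/dec/dbl
-- unfolded so that the ring solver can read them.
dbl-inc : ∀ a → + 2 ℤ.* (a + 1ℤ) ≡ (+ 2 ℤ.* a + 1ℤ) + 1ℤ
dbl-inc = solve-∀

neg-dbl : ∀ a → ℤ.- (+ 2 ℤ.* a) ≡ + 2 ℤ.* (ℤ.- a)
neg-dbl = solve-∀

neg-odd : ∀ a → ℤ.- (+ 2 ℤ.* a + 1ℤ) ≡ + 2 ℤ.* (ℤ.- (a + 1ℤ)) + 1ℤ
neg-odd = solve-∀

dbl-dec : ∀ a → ((+ 2 ℤ.* a) - 1ℤ) - 1ℤ ≡ + 2 ℤ.* (a - 1ℤ)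
dbl-dec = solve-∀

odd-inc : ∀ a → ((+ 2 ℤ.* a + 1ℤ) + 1ℤ) + 1ℤ ≡ + 2 ℤ.* (a + 1ℤ) + 1ℤ
odd-inc = solve-∀

odd-dec : ∀ a → ((+ 2 ℤ.* a + 1ℤ) - 1ℤ) - 1ℤ ≡ + 2 ℤ.* (a - 1ℤ) + 1ℤ
odd-dec = solve-∀

dec-dbl : ∀ a → (+ 2 ℤ.* a) - 1ℤ ≡ + 2 ℤ.* (a - 1ℤ) + 1ℤ
dec-dbl = solve-∀

dec-inc : ∀ x → (x + 1ℤ) - 1ℤ ≡ x
dec-inc = solve-∀

inc-dec : ∀ x → (x - 1ℤ) + 1ℤ ≡ x
inc-dec = solve-∀

data EvenOdd : ℤ → Set where
  even : ∀ a → EvenOdd (dbl a)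
  odd  : ∀ a → EvenOdd (inc (dbl a))

evenOdd : ∀ x → EvenOdd x
evenOdd (+ n)     = evenOddℕ n
  where
  next : ∀ {x} → EvenOdd x → EvenOdd (inc x)
  next (even a) = odd a
  next (odd a)  = subst EvenOdd (dbl-inc a) (even (inc a))
  evenOddℕ : ∀ n → EvenOdd (+ n)
  evenOddℕ zero    = even (+ 0)
  evenOddℕ (suc n) = subst EvenOdd (cong +_ (ℕP.+-comm n 1)) (next (evenOddℕ n))
evenOdd -[1+ n ]  = negate (evenOdd (+ suc n))
  where
  negate : ∀ {x} → EvenOdd x → EvenOdd (ℤ.- x)
  negate (even a) = subst EvenOdd (sym (neg-dbl a)) (even (ℤ.- a))
  negate (odd a)  = subst EvenOdd (sym (neg-odd a)) (odd (ℤ.- inc a))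

parity-left : ∀ x y → parityℤ (x + dec y) ≡ not (parityℤ (x + y))
parity-left x y = trans (cong parityℤ (shift x y)) (parityℤ-dec (x + y))
  where
  shift : ∀ x y → x + (y - 1ℤ) ≡ (x + y) - 1ℤ
  shift = solve-∀

parity-right : ∀ x y → parityℤ (x + inc y) ≡ not (parityℤ (x + y))
parity-right x y = trans (cong parityℤ (shift x y)) (parityℤ-inc (x + y))
  where
  shift : ∀ x y → x + (y + 1ℤ) ≡ (x + y) + 1ℤ
  shift = solve-∀

parity-down : ∀ x y → parityℤ (inc x + y) ≡ not (parityℤ (x + y))
parity-down x y = trans (cong parityℤ (shift x y)) (parityℤ-inc (x + y))
  where
  shift : ∀ x y → (x + 1ℤ) + y ≡ (x + y) + 1ℤ
  shift = solve-∀

parity-up : ∀ x y → parityℤ (dec x + y) ≡ not (parityℤ (x + y))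
parity-up x y = trans (cong parityℤ (shift x y)) (parityℤ-dec (x + y))
  where
  shift : ∀ x y → (x - 1ℤ) + y ≡ (x + y) - 1ℤ
  shift = solve-∀

_≐_ : Config₁ → Config₁ → Set
c ≐ d = ∀ x y → c x y ≡ d x y

empty seed : Config₁
empty _ _ = false
seed = first C₀

seed-origin : ∀ x y → seed x y ≡ true → (x ≡ + 0) × (y ≡ + 0)
seed-origin (+ zero)  (+ zero)  _ = refl , refl
seed-origin (+ zero)  (+ suc n) ()
seed-origin (+ zero)  -[1+ n ]  ()
seed-origin (+ suc m) y         ()
seed-origin -[1+ m ]  y         ()

infix 4 _≐_
infixl 6 _⊕_

_⊕_ : Config₁ → Config₁ → Config₁
(c ⊕ d) x y = c x y xor d x y

plus cross : Config₁ → Config₁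
plus  c i j = c i (dec j) xor c i (inc j) xor c (inc i) j xor c (dec i) j
cross c i j = c (dec i) (dec j) xor c (dec i) (inc j) xor c (inc i) (dec j) xor c (inc i) (inc j)

orbit : (Config₁ → Config₁) → ℕ → Config₁
orbit L zero          = empty
orbit L (suc zero)    = seed
orbit L (suc (suc n)) = L (orbit L (suc n)) ⊕ orbit L n

s⁺ s× : ℕ → Config₁
s⁺ = orbit plus
s× = orbit cross

SupportedOn : {A : Set} → (ℤ → ℤ → A) → A → Config₁ → Set
SupportedOn colour v c = ∀ x y → c x y ≡ true → colour x y ≡ v

off-colour : ∀ {A} {colour : ℤ → ℤ → A} {v c} → SupportedOn colour v c →
             ∀ x y → ¬ colour x y ≡ v → c x y ≡ false
off-colour {c = c} supp x y wrong with c x y in live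
... | false = refl
... | true  = ⊥-elim (wrong (supp x y live))

orbit-supported : ∀ {A : Set} (colour : ℤ → ℤ → A) (flip : A → A) (hue : ℕ → A) L →
  (∀ v → flip (flip v) ≡ v) → (∀ n → hue (suc n) ≡ flip (hue n)) → colour (+ 0) (+ 0) ≡ hue 1 →
  (∀ v c → SupportedOn colour v c → SupportedOn colour (flip v) (L c)) →
  ∀ n → SupportedOn colour (hue n) (orbit L n)
orbit-supported colour flip hue L involutive hue-suc origin L-flips = go
  where
  go : ∀ n → SupportedOn colour (hue n) (orbit L n)
  go zero          x y ()
  go (suc zero)    x y live with refl , refl ← seed-origin x y live = origin
  go (suc (suc n)) x y live =
    [ (λ l → trans (L-flips _ _ (go (suc n)) x y l) (sym (hue-suc (suc n))))
    , (λ o → older (go n x y o)) ]′ (xor-true live)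
    where
    older : colour x y ≡ hue n → colour x y ≡ hue (suc (suc n))
    older eq = begin
      colour x y           ≡⟨ eq ⟩
      hue n                ≡⟨ involutive (hue n) ⟨
      flip (flip (hue n))  ≡⟨ cong flip (hue-suc n) ⟨
      flip (hue (suc n))   ≡⟨ hue-suc (suc n) ⟨
      hue (suc (suc n))    ∎
      where open ≡-Reasoning

diagonal : ℤ → ℤ → Bool
diagonal x y = parityℤ (x + y)

plus-flips : ∀ v c → SupportedOn diagonal v c → SupportedOn diagonal (not v) (plus c)
plus-flips v c supp x y live with xor4 _ _ _ _ live
... | inj₁ l                      = flipped (parity-left x y)  (supp _ _ l)
... | inj₂ (inj₁ l)               = flipped (parity-right x y) (supp _ _ l)
... | inj₂ (inj₂ (inj₁ l))        = flipped (parity-down x y)  (supp _ _ l)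
... | inj₂ (inj₂ (inj₂ l))        = flipped (parity-up x y)    (supp _ _ l)

doubleParity : ℤ → ℤ → Bool × Bool
doubleParity x y = parityℤ x , parityℤ y

flip² : Bool × Bool → Bool × Bool
flip² (a , b) = not a , not b

flipped² : ∀ x y x′ y′ {a b} → parityℤ x′ ≡ not (parityℤ x) → parityℤ y′ ≡ not (parityℤ y) →
           doubleParity x′ y′ ≡ (a , b) → doubleParity x y ≡ flip² (a , b)
flipped² _ _ _ _ px py e = cong₂ _,_ (flipped px (cong proj₁ e)) (flipped py (cong proj₂ e))

cross-flips : ∀ v c → SupportedOn doubleParity v c → SupportedOn doubleParity (flip² v) (cross c)
cross-flips (a , b) c supp x y live with xor4 _ _ _ _ live
... | inj₁ l               = flipped² x y (dec x) (dec y) (parityℤ-dec x) (parityℤ-dec y) (supp _ _ l)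
... | inj₂ (inj₁ l)        = flipped² x y (dec x) (inc y) (parityℤ-dec x) (parityℤ-inc y) (supp _ _ l)
... | inj₂ (inj₂ (inj₁ l)) = flipped² x y (inc x) (dec y) (parityℤ-inc x) (parityℤ-dec y) (supp _ _ l)
... | inj₂ (inj₂ (inj₂ l)) = flipped² x y (inc x) (inc y) (parityℤ-inc x) (parityℤ-inc y) (supp _ _ l)

s⁺-supported : ∀ n → SupportedOn diagonal (parity (suc n)) (s⁺ n)
s⁺-supported = orbit-supported diagonal not (λ n → parity (suc n)) plus
  not-involutive (λ _ → refl) refl plus-flips

s×-supported : ∀ n → SupportedOn doubleParity (parity (suc n) , parity (suc n)) (s× n)
s×-supported = orbit-supported doubleParity flip² (λ n → parity (suc n) , parity (suc n)) cross
  (λ { (a , b) → cong₂ _,_ (not-involutive a) (not-involutive b) }) (λ _ → refl) refl cross-flips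

s⁺-fresh : ∀ n x y → s⁺ (suc n) x y ≡ true → s⁺ n x y ≡ false
s⁺-fresh n x y live = off-colour (s⁺-supported n) x y (λ e → not-¬ e (s⁺-supported (suc n) x y live))

s×-fresh : ∀ n x y → s× (suc n) x y ≡ true → s× n x y ≡ false
s×-fresh n x y live = off-colour (s×-supported n) x y
  (λ e → not-¬ (cong proj₁ e) (cong proj₁ (s×-supported (suc n) x y live)))

plus-cong : ∀ {c d} → c ≐ d → plus c ≐ plus d
plus-cong c≐d i j = cong₂ _xor_ (c≐d _ _) (cong₂ _xor_ (c≐d _ _) (cong₂ _xor_ (c≐d _ _) (c≐d _ _)))

plus-linear : ∀ c d → plus (c ⊕ d) ≐ plus c ⊕ plus d
plus-linear c d i j = regroup (c i (dec j)) (d i (dec j)) (c i (inc j)) (d i (inc j))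
                              (c (inc i) j) (d (inc i) j) (c (dec i) j) (d (dec i) j)
  where
  regroup : Pointwise 8 (λ a₁ b₁ a₂ b₂ a₃ b₃ a₄ b₄ → (a₁ xor b₁) xor (a₂ xor b₂) xor (a₃ xor b₃) xor (a₄ xor b₄))
                        (λ a₁ b₁ a₂ b₂ a₃ b₃ a₄ b₄ → (a₁ xor a₂ xor a₃ xor a₄) xor (b₁ xor b₂ xor b₃ xor b₄))
  regroup = truthTable 8 _ _ refl

plus₂ : Config₁ → Config₁
plus₂ c i j = c i (dec (dec j)) xor c i (inc (inc j)) xor c (inc (inc i)) j xor c (dec (dec i)) j

-- Squaring is additive in characteristic 2: applying the plus rule twice gives
-- the plus stencil at distance 2 (each mixed and central term occurs twice).
frobenius : ∀ c → plus (plus c) ≐ plus₂ c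
frobenius c i j = cancel (c i (dec (dec j))) (c i (inc (inc j))) (c (inc (inc i)) j) (c (dec (dec i)) j)
  (c i (inc (dec j))) (c i (dec (inc j))) (c (dec (inc i)) j) (c (inc (dec i)) j)
  (c (inc i) (dec j)) (c (dec i) (dec j)) (c (inc i) (inc j)) (c (dec i) (inc j))
  (cong (c i) (trans (inc-dec j) (sym (dec-inc j))))
  (trans (cong (c i) (dec-inc j)) (cong (λ z → c z j) (sym (dec-inc i))))
  (cong (λ z → c z j) (trans (dec-inc i) (sym (inc-dec i))))
  where
  table : Pointwise 9 (λ A B C D O d₁ d₂ d₃ d₄ →
    (A xor O xor d₁ xor d₂) xor (O xor B xor d₃ xor d₄) xor (d₁ xor d₃ xor C xor O) xor (d₂ xor d₄ xor O xor D))
    (λ A B C D O d₁ d₂ d₃ d₄ → A xor B xor C xor D)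
  table = truthTable 9 _ _ refl
  cancel : ∀ A B C D O₁ O₂ O₃ O₄ d₁ d₂ d₃ d₄ → O₁ ≡ O₂ → O₂ ≡ O₃ → O₃ ≡ O₄ →
    (A xor O₁ xor d₁ xor d₂) xor (O₂ xor B xor d₃ xor d₄) xor (d₁ xor d₃ xor C xor O₃) xor (d₂ xor d₄ xor O₄ xor D)
    ≡ A xor B xor C xor D
  cancel A B C D O .O .O .O d₁ d₂ d₃ d₄ refl refl refl = table A B C D O d₁ d₂ d₃ d₄

-- Doubling of natural numbers, in the form that matches the recursion of orbits.
twice : ℕ → ℕ
twice zero    = zero
twice (suc n) = suc (suc (twice n))

-- Halving the time: by linearity and the Frobenius identity, the plus orbit at
-- times 2m + 1 and 2m + 2 is expressed through the orbit of plus₂ at time ≈ m.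
halving : ∀ m → (s⁺ (suc (twice m)) ≐ orbit plus₂ (suc m) ⊕ orbit plus₂ m)
              × (s⁺ (suc (suc (twice m))) ≐ plus (orbit plus₂ (suc m)))
halving zero    = (λ x y → sym (xor-identityʳ _)) , (λ x y → xor-identityʳ _)
halving (suc m) = oddStep , evenStep
  where
  e = orbit plus₂
  oddStep : s⁺ (suc (twice (suc m))) ≐ e (suc (suc m)) ⊕ e (suc m)
  oddStep x y = begin
    plus (s⁺ (suc (suc (twice m)))) x y xor s⁺ (suc (twice m)) x y
      ≡⟨ cong₂ _xor_ (trans (plus-cong (proj₂ (halving m)) x y) (frobenius (e (suc m)) x y))
                     (proj₁ (halving m) x y) ⟩
    plus₂ (e (suc m)) x y xor (e (suc m) x y xor e m x y)
      ≡⟨ reassociate (plus₂ (e (suc m)) x y) (e (suc m) x y) (e m x y) ⟩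
    (plus₂ (e (suc m)) x y xor e m x y) xor e (suc m) x y ∎
    where
    open ≡-Reasoning
    reassociate : Pointwise 3 (λ A B C → A xor (B xor C)) (λ A B C → (A xor C) xor B)
    reassociate = truthTable 3 _ _ refl
  evenStep : s⁺ (suc (suc (twice (suc m)))) ≐ plus (e (suc (suc m)))
  evenStep x y = begin
    plus (s⁺ (suc (twice (suc m)))) x y xor s⁺ (suc (suc (twice m))) x y
      ≡⟨ cong₂ _xor_ (trans (plus-cong oddStep x y) (plus-linear (e (suc (suc m))) (e (suc m)) x y))
                     (proj₂ (halving m) x y) ⟩
    (plus (e (suc (suc m))) x y xor plus (e (suc m)) x y) xor plus (e (suc m)) x y
      ≡⟨ cancel (plus (e (suc (suc m))) x y) (plus (e (suc m)) x y) ⟩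
    plus (e (suc (suc m))) x y ∎
    where
    open ≡-Reasoning
    cancel : Pointwise 2 (λ A B → (A xor B) xor B) (λ A B → A)
    cancel = truthTable 2 _ _ refl

record Dilation (d c : Config₁) : Set where
  field
    on-lattice : ∀ a b → d (dbl a) (dbl b) ≡ c a b
    odd-row    : ∀ a y → d (inc (dbl a)) y ≡ false
    odd-column : ∀ x b → d x (inc (dbl b)) ≡ false

odd≢0 : ∀ a → ¬ inc (dbl a) ≡ + 0
odd≢0 a eq with () ← trans (sym (parityℤ-odd a)) (cong parityℤ eq)

seed-dilation : Dilation seed seed
seed-dilation = record { on-lattice = lattice ; odd-row = row ; odd-column = column }
  where
  lattice : ∀ a b → seed (dbl a) (dbl b) ≡ seed a b
  lattice (+ zero)  (+ zero)  = refl
  lattice (+ zero)  (+ suc n) = refl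
  lattice (+ zero)  -[1+ n ]  = refl
  lattice (+ suc m) b         = refl
  lattice -[1+ m ]  b         = refl
  row : ∀ a y → seed (inc (dbl a)) y ≡ false
  row a y with seed (inc (dbl a)) y in live
  ... | false = refl
  ... | true  = ⊥-elim (odd≢0 a (proj₁ (seed-origin (inc (dbl a)) y live)))
  column : ∀ x b → seed x (inc (dbl b)) ≡ false
  column x b with seed x (inc (dbl b)) in live
  ... | false = refl
  ... | true  = ⊥-elim (odd≢0 b (proj₂ (seed-origin x (inc (dbl b)) live)))

dilation-resp : ∀ {d d′ c} → d ≐ d′ → Dilation d c → Dilation d′ c
dilation-resp d≐d′ D = record
  { on-lattice = λ a b → trans (sym (d≐d′ _ _)) (on-lattice a b)
  ; odd-row    = λ a y → trans (sym (d≐d′ _ _)) (odd-row a y)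
  ; odd-column = λ x b → trans (sym (d≐d′ _ _)) (odd-column x b) }
  where open Dilation D

⊕-dilation : ∀ {d d′ c c′} → Dilation d c → Dilation d′ c′ → Dilation (d ⊕ d′) (c ⊕ c′)
⊕-dilation D D′ = record
  { on-lattice = λ a b → cong₂ _xor_ (on-lattice D a b) (on-lattice D′ a b)
  ; odd-row    = λ a y → cong₂ _xor_ (odd-row D a y) (odd-row D′ a y)
  ; odd-column = λ x b → cong₂ _xor_ (odd-column D x b) (odd-column D′ x b) }
  where open Dilation

plus₂-dilation : ∀ {d c} → Dilation d c → Dilation (plus₂ d) (plus c)
plus₂-dilation {d} {c} D = record { on-lattice = lattice ; odd-row = row ; odd-column = column }
  where
  open Dilation D
  lattice : ∀ a b → plus₂ d (dbl a) (dbl b) ≡ plus c a b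
  lattice a b =
    cong₂ _xor_ (trans (cong (d (dbl a)) (dbl-dec b)) (on-lattice a (dec b)))
    (cong₂ _xor_ (trans (cong (d (dbl a)) (sym (dbl-inc b))) (on-lattice a (inc b)))
    (cong₂ _xor_ (trans (cong (λ z → d z (dbl b)) (sym (dbl-inc a))) (on-lattice (inc a) b))
                 (trans (cong (λ z → d z (dbl b)) (dbl-dec a)) (on-lattice (dec a) b))))
  row : ∀ a y → plus₂ d (inc (dbl a)) y ≡ false
  row a y =
    cong₂ _xor_ (odd-row a _)
    (cong₂ _xor_ (odd-row a _)
    (cong₂ _xor_ (trans (cong (λ z → d z y) (odd-inc a)) (odd-row (inc a) y))
                 (trans (cong (λ z → d z y) (odd-dec a)) (odd-row (dec a) y))))
  column : ∀ x b → plus₂ d x (inc (dbl b)) ≡ false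
  column x b =
    cong₂ _xor_ (trans (cong (d x) (odd-dec b)) (odd-column x (dec b)))
    (cong₂ _xor_ (trans (cong (d x) (odd-inc b)) (odd-column x (inc b)))
    (cong₂ _xor_ (odd-column _ b) (odd-column _ b)))

orbit-dilation : ∀ n → Dilation (orbit plus₂ n) (s⁺ n)
orbit-dilation zero          = record { on-lattice = λ _ _ → refl ; odd-row = λ _ _ → refl ; odd-column = λ _ _ → refl }
orbit-dilation (suc zero)    = seed-dilation
orbit-dilation (suc (suc n)) = ⊕-dilation (plus₂-dilation (orbit-dilation (suc n))) (orbit-dilation n)

module PlusOfDilation {d c : Config₁} (D : Dilation d c) where
  open Dilation D

  even-even : ∀ a b → plus d (dbl a) (dbl b) ≡ false
  even-even a b =
    cong₂ _xor_ (trans (cong (d (dbl a)) (dec-dbl b)) (odd-column _ (dec b)))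
    (cong₂ _xor_ (odd-column _ b)
    (cong₂ _xor_ (odd-row a _) (trans (cong (λ z → d z (dbl b)) (dec-dbl a)) (odd-row (dec a) _))))

  odd-odd : ∀ a b → plus d (inc (dbl a)) (inc (dbl b)) ≡ false
  odd-odd a b =
    cong₂ _xor_ (odd-row a _) (cong₂ _xor_ (odd-row a _) (cong₂ _xor_ (odd-column _ b) (odd-column _ b)))

  odd-even : ∀ a b → plus d (inc (dbl a)) (dbl b) ≡ c (inc a) b xor c a b
  odd-even a b =
    cong₂ _xor_ (odd-row a _) (cong₂ _xor_ (odd-row a _)
    (cong₂ _xor_ (trans (cong (λ z → d z (dbl b)) (sym (dbl-inc a))) (on-lattice (inc a) b))
                 (trans (cong (λ z → d z (dbl b)) (dec-inc (dbl a))) (on-lattice a b))))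

  even-odd : ∀ a b → plus d (dbl a) (inc (dbl b)) ≡ c a b xor c a (inc b)
  even-odd a b = trans
    (cong₂ _xor_ (trans (cong (d (dbl a)) (dec-inc (dbl b))) (on-lattice a b))
    (cong₂ _xor_ (trans (cong (d (dbl a)) (sym (dbl-inc b))) (on-lattice a (inc b)))
    (cong₂ _xor_ (odd-row a _) (trans (cong (λ z → d z (inc (dbl b))) (dec-dbl a)) (odd-row (dec a) _)))))
    (cong (c a b xor_) (xor-identityʳ (c a (inc b))))

odd-time : ∀ m → Dilation (s⁺ (suc (twice m))) (s⁺ (suc m) ⊕ s⁺ m)
odd-time m = dilation-resp (λ x y → sym (proj₁ (halving m) x y))
                           (⊕-dilation (orbit-dilation (suc m)) (orbit-dilation m))

module EvenTime (m : ℕ) where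
  S  = s⁺ (suc m)
  S′ = s⁺ (suc (suc (twice m)))

  private
    open PlusOfDilation (orbit-dilation (suc m))
    split : S′ ≐ plus (orbit plus₂ (suc m))
    split = proj₂ (halving m)

  at-even-even : ∀ a b → S′ (dbl a) (dbl b) ≡ false
  at-even-even a b = trans (split _ _) (even-even a b)

  at-odd-odd : ∀ a b → S′ (inc (dbl a)) (inc (dbl b)) ≡ false
  at-odd-odd a b = trans (split _ _) (odd-odd a b)

  at-odd-even : ∀ a b → S′ (inc (dbl a)) (dbl b) ≡ S (inc a) b xor S a b
  at-odd-even a b = trans (split _ _) (odd-even a b)

  at-even-odd : ∀ a b → S′ (dbl a) (inc (dbl b)) ≡ S a b xor S a (inc b)
  at-even-odd a b = trans (split _ _) (even-odd a b)

other-colour : ∀ n {x y x′ y′} → diagonal x′ y′ ≡ not (diagonal x y) →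
               s⁺ n x y ≡ true → s⁺ n x′ y′ ≡ false
other-colour n {x} {y} {x′} {y′} flip live = off-colour (s⁺-supported n) x′ y′
  (λ e → not-¬ (trans e (sym (s⁺-supported n x y live))) flip)

count4 : Bool → Bool → Bool → Bool → ℕ
count4 a b c d = b2n a ℕ.+ b2n b ℕ.+ b2n c ℕ.+ b2n d

-- (a record, so that the four states can be inferred from the type)
record NotThree (a b c d : Bool) : Set where
  constructor notThree
  field isn't-three : ¬ count4 a b c d ≡ 3
open NotThree

NoThree : Config₁ → Set
NoThree c = ∀ i j → NotThree (c i (dec j)) (c i (inc j)) (c (inc i) j) (c (dec i) j)

notThree-resp : ∀ {a b c d a′ b′ c′ d′} → a ≡ a′ → b ≡ b′ → c ≡ c′ → d ≡ d′ →
                NotThree a′ b′ c′ d′ → NotThree a b c d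
notThree-resp refl refl refl refl h = h

first-two-dead : ∀ {a b} c d → a ≡ false → b ≡ false → NotThree a b c d
first-two-dead true  true  refl refl = notThree λ ()
first-two-dead true  false refl refl = notThree λ ()
first-two-dead false true  refl refl = notThree λ ()
first-two-dead false false refl refl = notThree λ ()

last-two-dead : ∀ a b {c d} → c ≡ false → d ≡ false → NotThree a b c d
last-two-dead true  true  refl refl = notThree λ ()
last-two-dead true  false refl refl = notThree λ ()
last-two-dead false true  refl refl = notThree λ ()
last-two-dead false false refl refl = notThree λ ()

-- Three live neighbours would make their sum mod 2 equal to 1.
even-not-three : ∀ a b c d → a xor b xor c xor d ≡ false → NotThree a b c d
even-not-three a b c d sum≡0 = notThree (λ three → true≢false (trans (sym (odd-if-three a b c d three)) sum≡0))
  where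
  odd-if-three : ∀ a b c d → count4 a b c d ≡ 3 → a xor b xor c xor d ≡ true
  odd-if-three true  true  true  false _ = refl
  odd-if-three true  true  false true  _ = refl
  odd-if-three true  false true  true  _ = refl
  odd-if-three false true  true  false ()
  odd-if-three false true  true  true  _ = refl
  odd-if-three true  true  true  true  ()
  odd-if-three true  true  false false ()
  odd-if-three true  false true  false ()
  odd-if-three true  false false true  ()
  odd-if-three true  false false false ()
  odd-if-three false true  false true  ()
  odd-if-three false true  false false ()
  odd-if-three false false true  true  ()
  odd-if-three false false true  false ()
  odd-if-three false false false true  ()
  odd-if-three false false false false ()

isOne-count4 : ∀ a b c d → NotThree a b c d → isOne (count4 a b c d) ≡ a xor b xor c xor d
isOne-count4 true  true  true  true  h = refl
isOne-count4 true  true  true  false h = ⊥-elim (isn't-three h refl)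
isOne-count4 true  true  false true  h = ⊥-elim (isn't-three h refl)
isOne-count4 true  true  false false h = refl
isOne-count4 true  false true  true  h = ⊥-elim (isn't-three h refl)
isOne-count4 true  false true  false h = refl
isOne-count4 true  false false true  h = refl
isOne-count4 true  false false false h = refl
isOne-count4 false true  true  true  h = ⊥-elim (isn't-three h refl)
isOne-count4 false true  true  false h = refl
isOne-count4 false true  false true  h = refl
isOne-count4 false true  false false h = refl
isOne-count4 false false true  true  h = refl
isOne-count4 false false true  false h = refl
isOne-count4 false false false true  h = refl
isOne-count4 false false false false h = refl

-- In a dilation every cell has two neighbours with an odd coordinate.
dilation-noThree : ∀ {d c} → Dilation d c → NoThree d
dilation-noThree {d} D i j with evenOdd i | evenOdd j
... | _        | odd b  = last-two-dead _ _ (odd-column _ b) (odd-column _ b)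
  where open Dilation D
... | odd a    | even b = first-two-dead _ _ (odd-row a _) (odd-row a _)
  where open Dilation D
... | even a   | even b = first-two-dead _ _ (trans (cong (d (dbl a)) (dec-dbl b)) (odd-column _ (dec b))) (odd-column _ b)
  where open Dilation D

add-centre : ∀ X N₁ N₂ N₃ N₄ →
  (X ≡ true → (N₁ ≡ false) × (N₂ ≡ false) × (N₃ ≡ false) × (N₄ ≡ false)) →
  NotThree N₁ N₂ N₃ N₄ → NotThree (N₁ xor X) (X xor N₂) (N₃ xor X) (X xor N₄)
add-centre true  N₁ N₂ N₃ N₄ lonely _ with lonely refl
... | refl , refl , refl , refl = notThree λ ()
add-centre false N₁ N₂ N₃ N₄ _ h rewrite xor-identityʳ N₁ | xor-identityʳ N₃ = h

even-time-noThree : ∀ m → NoThree (s⁺ (suc m)) → NoThree (s⁺ (suc (suc (twice m))))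
even-time-noThree m ih i j with evenOdd i | evenOdd j
-- a cell of the dilated lattice: each neighbour is the sum of the centre S(a, b)
-- and one of its neighbours in S
... | even a | even b =
  notThree-resp
    (trans (cong (S′ (dbl a)) (dec-dbl b)) (trans (at-even-odd a (dec b)) (cong (λ z → S a (dec b) xor S a z) (inc-dec b))))
    (at-even-odd a b)
    (at-odd-even a b)
    (trans (cong (λ z → S′ z (dbl b)) (dec-dbl a)) (trans (at-odd-even (dec a) b) (cong (λ z → S z b xor S (dec a) b) (inc-dec a))))
    (add-centre (S a b) (S a (dec b)) (S a (inc b)) (S (inc a) b) (S (dec a) b)
      (λ live → other-colour (suc m) (parity-left a b) live , other-colour (suc m) (parity-right a b) live ,
                other-colour (suc m) (parity-down a b) live , other-colour (suc m) (parity-up a b) live)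
      (ih a b))
  where open EvenTime m
-- a cell between two lattice cells or two odd-odd cells, both dead
... | even a | odd b  = first-two-dead _ _
  (trans (cong (S′ (dbl a)) (dec-inc (dbl b))) (at-even-even a b))
  (trans (cong (S′ (dbl a)) (sym (dbl-inc b))) (at-even-even a (inc b)))
  where open EvenTime m
... | odd a  | even b = first-two-dead _ _
  (trans (cong (S′ (inc (dbl a))) (dec-dbl b)) (at-odd-odd a (dec b)))
  (at-odd-odd a b)
  where open EvenTime m
-- a cell between four lattice cells: each of the four cells of S around it is
-- counted by exactly two neighbours, so the number of live neighbours is even
... | odd a  | odd b  =
  notThree-resp
    (trans (cong (S′ (inc (dbl a))) (dec-inc (dbl b))) (at-odd-even a b))
    (trans (cong (S′ (inc (dbl a))) (sym (dbl-inc b))) (at-odd-even a (inc b)))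
    (trans (cong (λ z → S′ z (inc (dbl b))) (sym (dbl-inc a))) (at-even-odd (inc a) b))
    (trans (cong (λ z → S′ z (inc (dbl b))) (dec-inc (dbl a))) (at-even-odd a b))
    (even-not-three _ _ _ _ (cancel (S a b) (S (inc a) b) (S a (inc b)) (S (inc a) (inc b))))
  where
  open EvenTime m
  cancel : Pointwise 4 (λ A B C D → (B xor A) xor (D xor C) xor (B xor D) xor (A xor C)) (λ _ _ _ _ → false)
  cancel = truthTable 4 _ _ refl

data Halves : ℕ → Set where
  at-zero : Halves zero
  at-odd  : ∀ m → Halves (suc (twice m))
  at-even : ∀ m → Halves (suc (suc (twice m)))

halves : ∀ n → Halves n
halves zero = at-zero
halves (suc n) with halves n
... | at-zero   = at-odd zero
... | at-odd m  = at-even m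
... | at-even m = at-odd (suc m)

m≤twice : ∀ m → m ℕ.≤ twice m
m≤twice zero    = ℕ.z≤n
m≤twice (suc m) = ℕP.≤-trans (ℕ.s≤s (m≤twice m)) (ℕP.n≤1+n _)

noThree : ∀ n → NoThree (s⁺ n)
noThree = <-rec (λ n → NoThree (s⁺ n)) byHalves
  where
  byHalves : ∀ n → (∀ {k} → k < n → NoThree (s⁺ k)) → NoThree (s⁺ n)
  byHalves n rec with halves n
  ... | at-zero   = λ i j → notThree λ ()
  ... | at-odd m  = dilation-noThree (odd-time m)
  ... | at-even m = even-time-noThree m (rec (ℕ.s≤s (ℕ.s≤s (m≤twice m))))

linear : Rule → Config₁ → Config₁
linear C1  = cross
linear C2  = plus
linear C3  = plus
linear C3' = plus

orbitOf : Rule → ℕ → Config₁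
orbitOf r = orbit (linear r)

sum4-parity : Pointwise 4 (λ a b c d → parity (count4 a b c d)) (λ a b c d → a xor b xor c xor d)
sum4-parity = truthTable 4 _ _ refl

rule-cross : ∀ c i j → rule C1 c i j ≡ cross c i j
rule-cross c i j = sum4-parity (c (dec i) (dec j)) (c (dec i) (inc j)) (c (inc i) (dec j)) (c (inc i) (inc j))

rule-plus : ∀ c i j → rule C2 c i j ≡ plus c i j
rule-plus c i j = sum4-parity (c i (dec j)) (c i (inc j)) (c (inc i) j) (c (dec i) j)

count4-dead : ∀ {a b c d} → a ≡ false → b ≡ false → c ≡ false → d ≡ false → count4 a b c d ≡ 0
count4-dead refl refl refl refl = refl

xor4-dead : ∀ {a b c d} → a ≡ false → b ≡ false → c ≡ false → d ≡ false → a xor b xor c xor d ≡ false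
xor4-dead refl refl refl refl = refl

dead-colour : ∀ n x y → diagonal x y ≡ parity n → s⁺ n x y ≡ false
dead-colour n x y same = off-colour (s⁺-supported n) x y (λ e → not-¬ same e)

-- Along its own orbit every rule coincides with its linear rule: for C3 because
-- no cell has three live neighbours, and for C3' because in addition either all
-- plus-neighbours or all cross-neighbours of a cell are dead.
agrees : ∀ r n → rule r (orbitOf r n) ≐ linear r (orbitOf r n)
agrees C1  n i j = rule-cross (s× n) i j
agrees C2  n i j = rule-plus (s⁺ n) i j
agrees C3  n i j = isOne-count4 _ _ _ _ (noThree n i j)
agrees C3' n i j with diagonal i j B.≟ parity n
... | yes same = begin
  isOne (sumP (s⁺ n) i j) ∧ isZero (sumX (s⁺ n) i j)
    ≡⟨ cong (λ k → isOne (sumP (s⁺ n) i j) ∧ isZero k) (count4-dead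
         (dead-colour n _ _ (trans (flipped-twice (parity-up i (dec j)) (parity-left i j)) same))
         (dead-colour n _ _ (trans (flipped-twice (parity-up i (inc j)) (parity-right i j)) same))
         (dead-colour n _ _ (trans (flipped-twice (parity-down i (dec j)) (parity-left i j)) same))
         (dead-colour n _ _ (trans (flipped-twice (parity-down i (inc j)) (parity-right i j)) same))) ⟩
  isOne (sumP (s⁺ n) i j) ∧ true
    ≡⟨ ∧-identityʳ _ ⟩
  isOne (sumP (s⁺ n) i j)
    ≡⟨ isOne-count4 _ _ _ _ (noThree n i j) ⟩
  plus (s⁺ n) i j ∎
  where open ≡-Reasoning
... | no other = trans (cong (λ k → isOne k ∧ isZero (sumX (s⁺ n) i j)) (count4-dead n₁ n₂ n₃ n₄))
                       (sym (xor4-dead n₁ n₂ n₃ n₄))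
  where
  live-colour : diagonal i j ≡ not (parity n)
  live-colour = ¬-not other
  neighbour : ∀ {x y} → diagonal x y ≡ not (diagonal i j) → s⁺ n x y ≡ false
  neighbour flip = dead-colour n _ _ (flipped-twice flip live-colour)
  n₁ = neighbour (parity-left i j)
  n₂ = neighbour (parity-right i j)
  n₃ = neighbour (parity-down i j)
  n₄ = neighbour (parity-up i j)

count4-resp : ∀ {a b c d a′ b′ c′ d′} → a ≡ a′ → b ≡ b′ → c ≡ c′ → d ≡ d′ → count4 a b c d ≡ count4 a′ b′ c′ d′
count4-resp refl refl refl refl = refl

rule-cong : ∀ r {c d} → c ≐ d → rule r c ≐ rule r d
rule-cong C1  c≐d i j = cong parity (count4-resp (c≐d _ _) (c≐d _ _) (c≐d _ _) (c≐d _ _))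
rule-cong C2  c≐d i j = cong parity (count4-resp (c≐d _ _) (c≐d _ _) (c≐d _ _) (c≐d _ _))
rule-cong C3  c≐d i j = cong isOne (count4-resp (c≐d _ _) (c≐d _ _) (c≐d _ _) (c≐d _ _))
rule-cong C3' c≐d i j = cong₂ _∧_ (cong isOne (count4-resp (c≐d _ _) (c≐d _ _) (c≐d _ _) (c≐d _ _)))
                                  (cong isZero (count4-resp (c≐d _ _) (c≐d _ _) (c≐d _ _) (c≐d _ _)))

rule-empty : ∀ r i j → rule r empty i j ≡ false
rule-empty C1  i j = refl
rule-empty C2  i j = refl
rule-empty C3  i j = refl
rule-empty C3' i j = refl

C₀-split : ∀ i j → C₀ i j ≡ (seed i j , false)
C₀-split (+ zero)  (+ zero)  = refl
C₀-split (+ zero)  (+ suc n) = refl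
C₀-split (+ zero)  -[1+ n ]  = refl
C₀-split (+ suc m) j         = refl
C₀-split -[1+ m ]  j         = refl

forward : ∀ r n i j → iter (step r) n C₀ i j ≡ (orbitOf r (suc n) i j , orbitOf r n i j)
forward r zero    i j = C₀-split i j
forward r (suc n) i j = cong₂ _,_
  (cong₂ _xor_ (trans (rule-cong r (λ x y → cong proj₁ (forward r n x y)) i j) (agrees r (suc n) i j))
               (cong proj₂ (forward r n i j)))
  (cong proj₁ (forward r n i j))

backward : ∀ r n i j → iter (unstep r) (suc n) C₀ i j ≡ (orbitOf r n i j , orbitOf r (suc n) i j)
backward r zero    i j = cong₂ _,_ (cong proj₂ (C₀-split i j))
  (cong₂ _xor_ (trans (rule-cong r (λ x y → cong proj₂ (C₀-split x y)) i j) (rule-empty r i j))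
               (cong proj₁ (C₀-split i j)))
backward r (suc n) i j = cong₂ _,_
  (cong proj₂ (backward r n i j))
  (cong₂ _xor_ (trans (rule-cong r (λ x y → cong proj₂ (backward r n x y)) i j) (agrees r (suc n) i j))
               (cong proj₁ (backward r n i j)))

Count : {A : Set} → (A → Set) → ℕ → Set
Count {A} P m = Σ (List A) λ L → Unique L × (∀ x → (x ∈ L) ⇔ P x) × length L ≡ m

module _ {A : Set} where
  open Equivalence

  -- Two duplicate-free lists with the same members are permutations of each other.
  count-unique : ∀ {P : A → Set} {m m′} → Count P m → Count P m′ → m ≡ m′
  count-unique (L , uL , memL , lenL) (L′ , uL′ , memL′ , lenL′) =
    trans (sym lenL) (trans (↭-length (∼bag⇒↭ (unique∧set⇒bag uL uL′ sameMembers))) lenL′)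
    where
    sameMembers : ∀ {x} → (x ∈ L) ⇔ (x ∈ L′)
    sameMembers {x} = mk⇔ (λ h → from (memL′ x) (to (memL x) h)) (λ h → from (memL x) (to (memL′ x) h))

  count-resp : ∀ {P Q : A → Set} {m} → (∀ x → P x ⇔ Q x) → Count P m → Count Q m
  count-resp P⇔Q (L , uL , memL , lenL) = L , uL , mem , lenL
    where
    mem : ∀ x → (x ∈ L) ⇔ _
    mem x = mk⇔ (λ h → to (P⇔Q x) (to (memL x) h)) (λ q → from (memL x) (from (P⇔Q x) q))

  count-none : ∀ {P : A → Set} → (∀ x → ¬ P x) → Count P 0
  count-none none = [] , [] , (λ x → mk⇔ (λ ()) (λ p → ⊥-elim (none x p))) , refl

  count-single : ∀ (a : A) → Count (_≡ a) 1
  count-single a = (a ∷ []) , (All.[] ∷ []) , (λ x → mk⇔ (λ { (here eq) → eq ; (there ()) }) here) , refl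

  count-∪ : ∀ {P Q : A → Set} {m n} → (∀ x → P x → ¬ Q x) →
            Count P m → Count Q n → Count (λ x → P x ⊎ Q x) (m ℕ.+ n)
  count-∪ {P} {Q} disjoint (L , uL , memL , lenL) (K , uK , memK , lenK) =
    L ++ K , Unique.++⁺ uL uK apart , mem , trans (length-++ L) (cong₂ ℕ._+_ lenL lenK)
    where
    apart : ∀ {x} → ¬ (x ∈ L × x ∈ K)
    apart {x} (inL , inK) = disjoint x (to (memL x) inL) (to (memK x) inK)
    mem : ∀ x → (x ∈ L ++ K) ⇔ (P x ⊎ Q x)
    mem x = mk⇔ (λ h → Data.Sum.map (to (memL x)) (to (memK x)) (∈-++⁻ L h))
                [ (λ p → ∈-++⁺ˡ (from (memL x) p)) , (λ q → ∈-++⁺ʳ L (from (memK x) q)) ]′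

Image : {A B : Set} → (A → B) → (A → Set) → B → Set
Image {A} f P y = Σ A λ x → P x × f x ≡ y

count-image : ∀ {A B : Set} {P : A → Set} {m} (f : A → B) → Injective _≡_ _≡_ f →
              Count P m → Count (Image f P) m
count-image {P = P} f f-inj (L , uL , memL , lenL) =
  map f L , Unique.map⁺ f-inj uL , mem , trans (length-map f L) lenL
  where
  open Equivalence
  mem : ∀ y → (y ∈ map f L) ⇔ Image f P y
  mem y = mk⇔ (λ h → let (x , inL , eq) = ∈-map⁻ f h in x , to (memL x) inL , sym eq)
              (λ { (x , p , refl) → ∈-map⁺ f (from (memL x) p) })

count-preimage : ∀ {A : Set} {P : A → Set} {m} (f g : A → A) →
  (∀ x → g (f x) ≡ x) → (∀ y → f (g y) ≡ y) → Count P m → Count (λ x → P (f x)) m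
count-preimage {P = P} f g gf fg C = count-resp pullback (count-image g g-injective C)
  where
  g-injective : Injective _≡_ _≡_ g
  g-injective {a} {b} eq = trans (sym (fg a)) (trans (cong f eq) (fg b))
  pullback : ∀ y → Image g P y ⇔ P (f y)
  pullback y = mk⇔ (λ { (x , p , refl) → subst P (sym (fg x)) p }) (λ p → f y , p , gf y)

Live : Config₁ → Cell → Set
Live c p = c (proj₁ p) (proj₂ p) ≡ true

xor-exclusive : ∀ {a b} → (a ≡ true → b ≡ false) → (a xor b ≡ true) ⇔ (a ≡ true ⊎ b ≡ true)
xor-exclusive {true}  {false} _     = mk⇔ (λ _ → inj₁ refl) (λ _ → refl)
xor-exclusive {true}  {true}  fresh with () ← fresh refl
xor-exclusive {false} {b}     _     = mk⇔ inj₂ [ (λ ()) , (λ l → l) ]′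

live-⊕ : ∀ {c d} → (∀ p → Live c p → d (proj₁ p) (proj₂ p) ≡ false) →
         ∀ p → Live (c ⊕ d) p ⇔ (Live c p ⊎ Live d p)
live-⊕ apart p = xor-exclusive (apart p)

toEvenEven toOddEven toEvenOdd : Cell → Cell
toEvenEven (a , b) = dbl a , dbl b
toOddEven  (a , b) = inc (dbl a) , dbl b
toEvenOdd  (a , b) = dbl a , inc (dbl b)

dbl-injective : Injective _≡_ _≡_ dbl
dbl-injective {a} {b} = ℤP.*-cancelˡ-≡ (+ 2) a b

inc-injective : Injective _≡_ _≡_ inc
inc-injective {a} {b} eq = trans (sym (dec-inc a)) (trans (cong dec eq) (dec-inc b))

×-injective : ∀ {f g : ℤ → ℤ} → Injective _≡_ _≡_ f → Injective _≡_ _≡_ g →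
              Injective _≡_ _≡_ (λ (p : Cell) → f (proj₁ p) , g (proj₂ p))
×-injective f-inj g-inj eq = cong₂ _,_ (f-inj (cong proj₁ eq)) (g-inj (cong proj₂ eq))

odd≢even : ∀ a b → ¬ inc (dbl a) ≡ dbl b
odd≢even a b eq with () ← trans (sym (parityℤ-odd a)) (trans (cong parityℤ eq) (parityℤ-dbl b))

dilation-live : ∀ {d c} → Dilation d c → ∀ p → Live d p ⇔ Image toEvenEven (Live c) p
dilation-live {d} {c} D (x , y) = mk⇔ (to′ (evenOdd x) (evenOdd y)) from′
  where
  open Dilation D
  to′ : ∀ {x y} → EvenOdd x → EvenOdd y → d x y ≡ true → Image toEvenEven (Live c) (x , y)
  to′ (even a) (even b) live = (a , b) , trans (sym (on-lattice a b)) live , refl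
  to′ (odd a)  _        live with () ← trans (sym live) (odd-row a _)
  to′ (even a) (odd b)  live with () ← trans (sym live) (odd-column _ b)
  from′ : Image toEvenEven (Live c) (x , y) → d x y ≡ true
  from′ ((a , b) , live , refl) = trans (on-lattice a b) live

count-odd-time : ∀ m {k k′} → Count (Live (s⁺ (suc m))) k → Count (Live (s⁺ m)) k′ →
                 Count (Live (s⁺ (suc (twice m)))) (k ℕ.+ k′)
count-odd-time m C C′ =
  count-resp (λ p → ⇔.sym (dilation-live (odd-time m) p))
    (count-image toEvenEven (×-injective dbl-injective dbl-injective)
      (count-resp (λ p → ⇔.sym (live-⊕ (λ q → s⁺-fresh m (proj₁ q) (proj₂ q)) p))
        (count-∪ (λ q live live′ → true≢false (trans (sym live′) (s⁺-fresh m _ _ live))) C C′)))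

count-shift-x : ∀ {c k} → Count (Live c) k → Count (Live (λ a b → c (inc a) b)) k
count-shift-x = count-preimage (λ p → inc (proj₁ p) , proj₂ p) (λ p → dec (proj₁ p) , proj₂ p)
  (λ p → cong (_, proj₂ p) (dec-inc (proj₁ p))) (λ p → cong (_, proj₂ p) (inc-dec (proj₁ p)))

count-shift-y : ∀ {c k} → Count (Live c) k → Count (Live (λ a b → c a (inc b))) k
count-shift-y = count-preimage (λ p → proj₁ p , inc (proj₂ p)) (λ p → proj₁ p , dec (proj₂ p))
  (λ p → cong (proj₁ p ,_) (dec-inc (proj₂ p))) (λ p → cong (proj₁ p ,_) (inc-dec (proj₂ p)))

-- At even times every live cell at half time contributes four live cells: two on
-- the horizontal and two on the vertical edges around it.
module EvenTimeCount (m : ℕ) where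
  open EvenTime m

  horizontal vertical : Config₁
  horizontal a b = S (inc a) b xor S a b
  vertical   a b = S a b xor S a (inc b)

  even-live : ∀ p → Live S′ p ⇔ (Image toOddEven (Live horizontal) p ⊎ Image toEvenOdd (Live vertical) p)
  even-live (x , y) = mk⇔ (to′ (evenOdd x) (evenOdd y)) from′
    where
    to′ : ∀ {x y} → EvenOdd x → EvenOdd y → S′ x y ≡ true →
          Image toOddEven (Live horizontal) (x , y) ⊎ Image toEvenOdd (Live vertical) (x , y)
    to′ (odd a)  (even b) live = inj₁ ((a , b) , trans (sym (at-odd-even a b)) live , refl)
    to′ (even a) (odd b)  live = inj₂ ((a , b) , trans (sym (at-even-odd a b)) live , refl)
    to′ (even a) (even b) live with () ← trans (sym live) (at-even-even a b)
    to′ (odd a)  (odd b)  live with () ← trans (sym live) (at-odd-odd a b)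
    from′ : Image toOddEven (Live horizontal) (x , y) ⊎ Image toEvenOdd (Live vertical) (x , y) → S′ x y ≡ true
    from′ (inj₁ ((a , b) , live , refl)) = trans (at-odd-even a b) live
    from′ (inj₂ ((a , b) , live , refl)) = trans (at-even-odd a b) live

  count-horizontal : ∀ {k} → Count (Live S) k → Count (Live horizontal) (k ℕ.+ k)
  count-horizontal C = count-resp (λ p → ⇔.sym (live-⊕ (λ q → right-dead (proj₁ q) (proj₂ q)) p))
    (count-∪ (λ q live live′ → true≢false (trans (sym live′) (right-dead _ _ live))) (count-shift-x C) C)
    where
    right-dead : ∀ a b → S (inc a) b ≡ true → S a b ≡ false
    right-dead a b = other-colour (suc m) (flipped (parity-down a b) refl)

  count-vertical : ∀ {k} → Count (Live S) k → Count (Live vertical) (k ℕ.+ k)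
  count-vertical C = count-resp (λ p → ⇔.sym (live-⊕ (λ q → up-dead (proj₁ q) (proj₂ q)) p))
    (count-∪ (λ q live live′ → true≢false (trans (sym live′) (up-dead _ _ live))) C (count-shift-y C))
    where
    up-dead : ∀ a b → S a b ≡ true → S a (inc b) ≡ false
    up-dead a b = other-colour (suc m) (parity-right a b)

  count-even-time : ∀ {k} → Count (Live S) k → Count (Live S′) ((k ℕ.+ k) ℕ.+ (k ℕ.+ k))
  count-even-time C = count-resp (λ p → ⇔.sym (even-live p))
    (count-∪ apart
      (count-image toOddEven (×-injective (λ eq → dbl-injective (inc-injective eq)) dbl-injective) (count-horizontal C))
      (count-image toEvenOdd (×-injective dbl-injective (λ eq → dbl-injective (inc-injective eq))) (count-vertical C)))
    where
    apart : ∀ p → Image toOddEven (Live horizontal) p → ¬ Image toEvenOdd (Live vertical) p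
    apart _ ((a , b) , _ , refl) ((a′ , b′) , _ , eq) = odd≢even a a′ (sym (cong proj₁ eq))

seed-live : ∀ p → (p ≡ (+ 0 , + 0)) ⇔ Live seed p
seed-live p = mk⇔ (λ { refl → refl }) (λ live → let (x≡0 , y≡0) = seed-origin _ _ live in cong₂ _,_ x≡0 y≡0)

plusCount : ∀ n → Σ ℕ (Count (Live (s⁺ n)))
plusCount = <-rec (λ n → Σ ℕ (Count (Live (s⁺ n)))) byHalves
  where
  byHalves : ∀ n → (∀ {k} → k < n → Σ ℕ (Count (Live (s⁺ k)))) → Σ ℕ (Count (Live (s⁺ n)))
  byHalves n rec with halves n
  ... | at-zero        = 0 , count-none (λ _ ())
  ... | at-odd zero    = 1 , count-resp seed-live (count-single (+ 0 , + 0))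
  ... | at-odd (suc m) = _ , count-odd-time (suc m) (proj₂ (rec {suc (suc m)} (ℕ.s≤s (ℕ.s≤s (ℕ.s≤s (m≤twice m))))))
                                                     (proj₂ (rec {suc m} (ℕ.s≤s (ℕ.s≤s (ℕP.m≤n⇒m≤1+n (m≤twice m))))))
  ... | at-even m      = _ , EvenTimeCount.count-even-time m (proj₂ (rec {suc m} (ℕ.s≤s (ℕ.s≤s (m≤twice m)))))

T : ℕ → ℕ
T n = proj₁ (plusCount n)

T-count : ∀ n → Count (Live (s⁺ n)) (T n)
T-count n = proj₂ (plusCount n)

T-zero : T 0 ≡ 0
T-zero = count-unique (T-count 0) (count-none (λ _ ()))

T-one : T 1 ≡ 1
T-one = count-unique (T-count 1) (count-resp seed-live (count-single (+ 0 , + 0)))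

T-odd : ∀ m → T (suc (twice m)) ≡ T (suc m) ℕ.+ T m
T-odd m = count-unique (T-count (suc (twice m))) (count-odd-time m (T-count (suc m)) (T-count m))

T-even : ∀ m → T (suc (suc (twice m))) ≡ 4 * T (suc m)
T-even m = trans (count-unique (T-count (suc (suc (twice m)))) (EvenTimeCount.count-even-time m (T-count (suc m))))
                 (four (T (suc m)))
  where
  four : ∀ k → (k ℕ.+ k) ℕ.+ (k ℕ.+ k) ≡ 4 * k
  four = ℕS.solve-∀

-- Rule C1 is rule C2 on the lattice rotated by 45°: (i, j) ↦ (i + j, i − j)
-- maps plus-neighbours to cross-neighbours.
rotate : Cell → Cell
rotate (i , j) = i + j , i - j

rotate-injective : Injective _≡_ _≡_ rotate
rotate-injective {i , j} {i′ , j′} eq = cong₂ _,_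
  (dbl-injective (trans (sym (sum i j)) (trans (cong₂ _+_ (cong proj₁ eq) (cong proj₂ eq)) (sum i′ j′))))
  (dbl-injective (trans (sym (difference i j)) (trans (cong₂ _-_ (cong proj₁ eq) (cong proj₂ eq)) (difference i′ j′))))
  where
  sum : ∀ i j → (i + j) + (i - j) ≡ + 2 ℤ.* i
  sum = solve-∀
  difference : ∀ i j → (i + j) - (i - j) ≡ + 2 ℤ.* j
  difference = solve-∀

seed-rotated : ∀ i j → seed i j ≡ seed (i + j) (i - j)
seed-rotated i j with seed i j in live | seed (i + j) (i - j) in live′
... | true  | true  = refl
... | false | false = refl
... | true  | false with refl , refl ← seed-origin i j live = live′
... | false | true  with refl ← rotate-injective {i , j} {+ 0 , + 0} (uncurry (cong₂ _,_) (seed-origin _ _ live′)) = sym live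

s⁺-rotated : ∀ n i j → s⁺ n i j ≡ s× n (i + j) (i - j)
s⁺-rotated zero          i j = refl
s⁺-rotated (suc zero)    i j = seed-rotated i j
s⁺-rotated (suc (suc n)) i j = cong₂ _xor_ (trans
  (cong₂ _xor_ (trans (s⁺-rotated (suc n) i (dec j)) (cong₂ S (left₁ i j) (left₂ i j)))
  (cong₂ _xor_ (trans (s⁺-rotated (suc n) i (inc j)) (cong₂ S (right₁ i j) (right₂ i j)))
  (cong₂ _xor_ (trans (s⁺-rotated (suc n) (inc i) j) (cong₂ S (down₁ i j) (down₂ i j)))
               (trans (s⁺-rotated (suc n) (dec i) j) (cong₂ S (up₁ i j) (up₂ i j))))))
  (reorder (S (dec u) (dec v)) (S (dec u) (inc v)) (S (inc u) (dec v)) (S (inc u) (inc v))))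
  (s⁺-rotated n i j)
  where
  S = s× (suc n)
  u = i + j
  v = i - j
  reorder : Pointwise 4 (λ A B C D → B xor C xor D xor A) (λ A B C D → A xor B xor C xor D)
  reorder = truthTable 4 _ _ refl
  left₁ : ∀ i j → i + (j - 1ℤ) ≡ (i + j) - 1ℤ
  left₁ = solve-∀
  left₂ : ∀ i j → i - (j - 1ℤ) ≡ (i - j) + 1ℤ
  left₂ = solve-∀
  right₁ : ∀ i j → i + (j + 1ℤ) ≡ (i + j) + 1ℤ
  right₁ = solve-∀
  right₂ : ∀ i j → i - (j + 1ℤ) ≡ (i - j) - 1ℤ
  right₂ = solve-∀
  down₁ : ∀ i j → (i + 1ℤ) + j ≡ (i + j) + 1ℤ
  down₁ = solve-∀
  down₂ : ∀ i j → (i + 1ℤ) - j ≡ (i - j) + 1ℤ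
  down₂ = solve-∀
  up₁ : ∀ i j → (i - 1ℤ) + j ≡ (i + j) - 1ℤ
  up₁ = solve-∀
  up₂ : ∀ i j → (i - 1ℤ) - j ≡ (i - j) - 1ℤ
  up₂ = solve-∀

-- Every live cell of the cross orbit has coordinates of equal parity, hence lies
-- in the image of the rotation.
rotation-onto : ∀ n a b → s× n a b ≡ true → Σ Cell λ p → rotate p ≡ (a , b)
rotation-onto n a b live = onto (evenOdd a) (evenOdd b) (cong proj₁ colour) (cong proj₂ colour)
  where
  colour = s×-supported n a b live
  onto : ∀ {a b} → EvenOdd a → EvenOdd b → parityℤ a ≡ parity (suc n) → parityℤ b ≡ parity (suc n) →
         Σ Cell λ p → rotate p ≡ (a , b)
  onto (even a) (even b) _ _ = (a + b , a - b) , cong₂ _,_ (sum a b) (difference a b)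
    where
    sum : ∀ a b → (a + b) + (a - b) ≡ + 2 ℤ.* a
    sum = solve-∀
    difference : ∀ a b → (a + b) - (a - b) ≡ + 2 ℤ.* b
    difference = solve-∀
  onto (odd a)  (odd b)  _ _ = ((a + b) + 1ℤ , a - b) , cong₂ _,_ (sum a b) (difference a b)
    where
    sum : ∀ a b → ((a + b) + 1ℤ) + (a - b) ≡ + 2 ℤ.* a + 1ℤ
    sum = solve-∀
    difference : ∀ a b → ((a + b) + 1ℤ) - (a - b) ≡ + 2 ℤ.* b + 1ℤ
    difference = solve-∀
  onto (even a) (odd b)  pa pb with () ← trans (sym (parityℤ-dbl a)) (trans pa (trans (sym pb) (parityℤ-odd b)))
  onto (odd a)  (even b) pa pb with () ← trans (sym (parityℤ-dbl b)) (trans pb (trans (sym pa) (parityℤ-odd a)))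

count-cross : ∀ n {k} → Count (Live (s⁺ n)) k → Count (Live (s× n)) k
count-cross n C = count-resp rotated (count-image rotate rotate-injective C)
  where
  rotated : ∀ q → Image rotate (Live (s⁺ n)) q ⇔ Live (s× n) q
  rotated (a , b) = mk⇔
    (λ { ((i , j) , live , refl) → trans (sym (s⁺-rotated n i j)) live })
    (λ live → let ((i , j) , eq) = rotation-onto n a b live
              in (i , j) , trans (s⁺-rotated n i j) (subst (Live (s× n)) (sym eq) live) , eq)

orbit-count : ∀ r n → Count (Live (orbitOf r n)) (T n)
orbit-count C1  n = count-cross n (T-count n)
orbit-count C2  n = T-count n
orbit-count C3  n = T-count n
orbit-count C3' n = T-count n

orbit-fresh : ∀ r n x y → orbitOf r (suc n) x y ≡ true → orbitOf r n x y ≡ false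
orbit-fresh C1  = s×-fresh
orbit-fresh C2  = s⁺-fresh
orbit-fresh C3  = s⁺-fresh
orbit-fresh C3' = s⁺-fresh

value-one : ∀ {c c′} → (c ≡ true → c′ ≡ false) → (value (c , c′) ≡ 1) ⇔ (c ≡ true)
value-one {true}  {false} _     = mk⇔ (λ _ → refl) (λ _ → refl)
value-one {true}  {true}  fresh with () ← fresh refl
value-one {false} {false} _     = mk⇔ (λ ()) (λ ())
value-one {false} {true}  _     = mk⇔ (λ ()) (λ ())

value-resp : ∀ {s t} → s ≡ t → (value s ≡ 1) ⇔ (value t ≡ 1)
value-resp refl = ⇔.refl

swap-fresh : ∀ {a b} → (a ≡ true → b ≡ false) → b ≡ true → a ≡ false
swap-fresh {false} _     _    = refl
swap-fresh {true}  fresh refl with () ← fresh refl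

numValueOne : ∀ {C c m} → (∀ i j → (value (C i j) ≡ 1) ⇔ (c i j ≡ true)) → Count (Live c) m → NumValueOne C m
numValueOne values (L , uL , memL , lenL) = L , uL , (λ i j → ⇔.trans (memL (i , j)) (⇔.sym (values i j))) , lenL

R₁ : ℤ → ℕ
R₁ (+ n)    = T (suc n)
R₁ -[1+ n ] = T n

count-value-one : ∀ r n → NumValueOne (Cn r n) (R₁ n)
count-value-one r (+ n) = numValueOne {C = Cn r (+ n)}
  (λ i j → ⇔.trans (value-resp (forward r n i j)) (value-one (orbit-fresh r n i j)))
  (orbit-count r (suc n))
count-value-one r -[1+ n ] = numValueOne {C = Cn r -[1+ n ]}
  (λ i j → ⇔.trans (value-resp (backward r n i j)) (value-one (swap-fresh (orbit-fresh r n i j))))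
  (orbit-count r n)

twice≡2* : ∀ n → twice n ≡ 2 * n
twice≡2* zero    = refl
twice≡2* (suc n) = trans (cong (λ m → suc (suc m)) (twice≡2* n)) (sym (ℕP.*-suc 2 n))

T-double : ∀ m → T (2 * m) ≡ 4 * T m
T-double zero    = trans T-zero (sym (cong (4 *_) T-zero))
T-double (suc m) = trans (cong T (sym (twice≡2* (suc m)))) (T-even m)

T-double+1 : ∀ m → T (suc (2 * m)) ≡ T (suc m) ℕ.+ T m
T-double+1 m = trans (cong (λ k → T (suc k)) (sym (twice≡2* m))) (T-odd m)

data ParityView : ℕ → Set where
  evenℕ : ∀ m → ParityView (2 * m)
  oddℕ  : ∀ m → ParityView (suc (2 * m))

parityView : ∀ n → ParityView n
parityView zero = evenℕ 0
parityView (suc n) with parityView n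
... | evenℕ m = oddℕ m
... | oddℕ m  = subst ParityView (ℕP.*-suc 2 m) (evenℕ (suc m))

even≢odd : ∀ x y → ¬ 2 * x ≡ suc (2 * y)
even≢odd x y eq = true≢false (sym (trans (sym (parity-double x)) (trans (cong parity eq) (cong not (parity-double y)))))

halve : ∀ {x y} → 2 * x ≡ 2 * y → x ≡ y
halve {x} {y} = ℕP.*-cancelˡ-≡ x y 2

-- It is proved by induction on k, splitting a and t
-- by parity (they have the same parity, as their sum is even for k > 0).
Dyadic : ℕ → Set
Dyadic k = ∀ a t → a ℕ.+ t ≡ 2 ^ k → T (2 * a ℕ.+ t) ≡ 4 * T a ℕ.+ T t

dyadic-base : Dyadic 0
dyadic-base zero          (suc zero)    refl = cong (λ z → 4 * z ℕ.+ T 1) (sym T-zero)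
dyadic-base (suc zero)    zero          refl = begin
  T (2 * 1 ℕ.+ 0)   ≡⟨ cong T (ℕP.+-identityʳ 2) ⟩
  T (2 * 1)         ≡⟨ T-double 1 ⟩
  4 * T 1           ≡⟨ ℕP.+-identityʳ _ ⟨
  4 * T 1 ℕ.+ 0     ≡⟨ cong (4 * T 1 ℕ.+_) T-zero ⟨
  4 * T 1 ℕ.+ T 0   ∎
  where open ≡-Reasoning
dyadic-base zero          zero          ()
dyadic-base zero          (suc (suc t)) ()
dyadic-base (suc zero)    (suc t)       ()
dyadic-base (suc (suc a)) t             ()

-- Both even: T(4a + 2t) = 4 T(2a + t), and T(2x) = 4 T(x) on both sides.
dyadic-even : ∀ k → Dyadic k → ∀ a t → 2 * a ℕ.+ 2 * t ≡ 2 ^ suc k →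
              T (2 * (2 * a) ℕ.+ 2 * t) ≡ 4 * T (2 * a) ℕ.+ T (2 * t)
dyadic-even k ih a t sum = begin
  T (2 * (2 * a) ℕ.+ 2 * t)          ≡⟨ cong T (regroup a t) ⟩
  T (2 * (2 * a ℕ.+ t))              ≡⟨ T-double (2 * a ℕ.+ t) ⟩
  4 * T (2 * a ℕ.+ t)                ≡⟨ cong (4 *_) (ih a t (halve (trans (ℕP.*-distribˡ-+ 2 a t) sum))) ⟩
  4 * (4 * T a ℕ.+ T t)              ≡⟨ ℕP.*-distribˡ-+ 4 (4 * T a) (T t) ⟩
  4 * (4 * T a) ℕ.+ 4 * T t          ≡⟨ cong₂ ℕ._+_ (cong (4 *_) (T-double a)) (T-double t) ⟨
  4 * T (2 * a) ℕ.+ T (2 * t)        ∎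
  where
  open ≡-Reasoning
  regroup : ∀ a t → 2 * (2 * a) ℕ.+ 2 * t ≡ 2 * (2 * a ℕ.+ t)
  regroup = ℕS.solve-∀

-- Both odd: 2(2a + 1) + (2t + 1) is odd, and T(2x + 1) = T(x + 1) + T(x) splits
-- it into two instances of the hypothesis, for (a + 1, t) and (a, t + 1).
dyadic-odd : ∀ k → Dyadic k → ∀ a t → suc (2 * a) ℕ.+ suc (2 * t) ≡ 2 ^ suc k →
             T (2 * suc (2 * a) ℕ.+ suc (2 * t)) ≡ 4 * T (suc (2 * a)) ℕ.+ T (suc (2 * t))
dyadic-odd k ih a t sum = begin
  T (2 * suc (2 * a) ℕ.+ suc (2 * t))                    ≡⟨ cong T (regroup a t) ⟩
  T (suc (2 * (2 * a ℕ.+ suc t)))                        ≡⟨ T-double+1 (2 * a ℕ.+ suc t) ⟩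
  T (suc (2 * a ℕ.+ suc t)) ℕ.+ T (2 * a ℕ.+ suc t)      ≡⟨ cong (λ z → T z ℕ.+ T (2 * a ℕ.+ suc t)) (shift a t) ⟩
  T (2 * suc a ℕ.+ t) ℕ.+ T (2 * a ℕ.+ suc t)            ≡⟨ cong₂ ℕ._+_ (ih (suc a) t half) (ih a (suc t) half′) ⟩
  (4 * T (suc a) ℕ.+ T t) ℕ.+ (4 * T a ℕ.+ T (suc t))    ≡⟨ collect (T (suc a)) (T a) (T (suc t)) (T t) ⟩
  4 * (T (suc a) ℕ.+ T a) ℕ.+ (T (suc t) ℕ.+ T t)        ≡⟨ cong₂ (λ x y → 4 * x ℕ.+ y) (T-double+1 a) (T-double+1 t) ⟨
  4 * T (suc (2 * a)) ℕ.+ T (suc (2 * t))                ∎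
  where
  open ≡-Reasoning
  regroup : ∀ a t → 2 * suc (2 * a) ℕ.+ suc (2 * t) ≡ suc (2 * (2 * a ℕ.+ suc t))
  regroup = ℕS.solve-∀
  shift : ∀ a t → suc (2 * a ℕ.+ suc t) ≡ 2 * suc a ℕ.+ t
  shift = ℕS.solve-∀
  collect : ∀ w x y z → (4 * w ℕ.+ z) ℕ.+ (4 * x ℕ.+ y) ≡ 4 * (w ℕ.+ x) ℕ.+ (y ℕ.+ z)
  collect = ℕS.solve-∀
  total : ∀ a t → suc (2 * a) ℕ.+ suc (2 * t) ≡ 2 * (suc a ℕ.+ t)
  total = ℕS.solve-∀
  half : suc a ℕ.+ t ≡ 2 ^ k
  half = halve (trans (sym (total a t)) sum)
  half′ : a ℕ.+ suc t ≡ 2 ^ k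
  half′ = trans (ℕP.+-suc a t) half

dyadic : ∀ k → Dyadic k
dyadic zero    = dyadic-base
dyadic (suc k) a t sum with parityView a | parityView t
... | evenℕ a | evenℕ t = dyadic-even k (dyadic k) a t sum
... | oddℕ a  | oddℕ t  = dyadic-odd k (dyadic k) a t sum
... | evenℕ a | oddℕ t  = ⊥-elim (even≢odd (2 ^ k) (a ℕ.+ t) (trans (sym sum) (mixed a t)))
  where
  mixed : ∀ a t → 2 * a ℕ.+ suc (2 * t) ≡ suc (2 * (a ℕ.+ t))
  mixed = ℕS.solve-∀
... | oddℕ a  | evenℕ t = ⊥-elim (even≢odd (2 ^ k) (a ℕ.+ t) (trans (sym sum) (mixed a t)))
  where
  mixed : ∀ a t → suc (2 * a) ℕ.+ 2 * t ≡ suc (2 * (a ℕ.+ t))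
  mixed = ℕS.solve-∀

R₁-before : ∀ t → R₁ (+ t - 1ℤ) ≡ T t
R₁-before zero    = refl
R₁-before (suc t) = refl

-- The recurrence of the theorem is `dyadic` with a = j + 1 and t = 2ᵏ − j − 1.
recurrence : ∀ k j → j < 2 ^ k → R₁ (+ (2 ^ k ℕ.+ j)) ≡ 4 * R₁ (+ j) ℕ.+ R₁ (+ (2 ^ k) - + j - + 2)
recurrence k j j<2ᵏ = begin
  T (suc (2 ^ k ℕ.+ j))                          ≡⟨ cong (λ z → T (suc (z ℕ.+ j))) (sym split) ⟩
  T (suc (suc j ℕ.+ t ℕ.+ j))                    ≡⟨ cong T (index j t) ⟩
  T (2 * suc j ℕ.+ t)                            ≡⟨ dyadic k (suc j) t split ⟩
  4 * T (suc j) ℕ.+ T t                          ≡⟨ cong (4 * T (suc j) ℕ.+_) (R₁-before t) ⟨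
  4 * R₁ (+ j) ℕ.+ R₁ (+ t - 1ℤ)                 ≡⟨ cong (λ z → 4 * R₁ (+ j) ℕ.+ R₁ z) offset ⟨
  4 * R₁ (+ j) ℕ.+ R₁ (+ (2 ^ k) - + j - + 2)    ∎
  where
  open ≡-Reasoning
  t = 2 ^ k ℕ.∸ suc j
  split : suc j ℕ.+ t ≡ 2 ^ k
  split = ℕP.m+[n∸m]≡n j<2ᵏ
  index : ∀ j t → suc (suc j ℕ.+ t ℕ.+ j) ≡ 2 * suc j ℕ.+ t
  index = ℕS.solve-∀
  cancel : ∀ x y → ((x + 1ℤ) + y - x) - + 2 ≡ y - 1ℤ
  cancel = solve-∀
  offset : + (2 ^ k) - + j - + 2 ≡ + t - 1ℤ
  offset = begin
    + (2 ^ k) - + j - + 2                  ≡⟨ cong (λ z → + z - + j - + 2) (sym split) ⟩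
    + (suc j ℕ.+ t) - + j - + 2            ≡⟨ cong (λ z → z - + j - + 2) (ℤP.pos-+ (suc j) t) ⟩
    (+ suc j + + t) - + j - + 2            ≡⟨ cong (λ z → (z + + t) - + j - + 2) (cong +_ (ℕP.+-comm 1 j)) ⟩
    ((+ j + 1ℤ) + + t) - + j - + 2         ≡⟨ cancel (+ j) (+ t) ⟩
    + t - 1ℤ                               ∎

mainTheorem4 : (r : Rule) →
    Σ (ℤ → ℕ) λ R₁ →
      (∀ n → NumValueOne (Cn r n) (R₁ n)) ×
      R₁ -[1+ 0 ] ≡ 0 ×
      R₁ (+ 0) ≡ 1 ×
      (∀ (k j : ℕ) → j < 2 ^ k →
        R₁ (+ (2 ^ k ℕ.+ j)) ≡ 4 * R₁ (+ j) ℕ.+ R₁ (+ (2 ^ k) - + j - + 2))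
mainTheorem4 r = R₁ , count-value-one r , T-zero , T-one , recurrence
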